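{- Let $G$ be a countable oriented graph. The following are equivalent: (i) $G$ is acyclic, locally-finite, and has no infinite directed paths; (ii) $G$ embeds into $K_\omega$ and $G$ embeds into $K_{\omega^*}$; (iii) $G$ is unavoidable, i.e. for every countably-infinite tournament $K$ there is an embedding of $G$ into $K$.
   Context: An oriented graph is a directed graph without loops such that $(u,v)\in E$ implies $(v,u)\notin E$; a tournament is an oriented graph with exactly one edge between each pair of distinct vertices. An embedding of $H$ into $G$ is an injection $\phi:V(H)\to V(G)$ with $(u,v)\in E(H)\Rightarrow(\phi(u),\phi(v))\in E(G)$. $K_\omega$ is the tournament on the set $\omega=\{0,1,2,\dots\}$ with $(i,j)$ an edge iff $i<j$, and $K_{\omega^*}$ is the tournament on $\omega$ with $(i,j)$ an edge iff $i>j$. Locally-finite means every vertex is incident with finitely many edges. A directed path is an orientation of a finite, one-way-infinite or two-way-infinite path with no vertex of in-degree 2 or out-degree 2; an infinite directed path is an infinite such path contained in $G$. -}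

module Defs where

open import Level using (0ℓ)
open import Data.Nat using (ℕ; zero; suc; _<_; _>_)
open import Data.Integer using (ℤ) renaming (suc to sucℤ)
open import Data.Product using (Σ; ∃; _×_; _,_)
open import Data.Sum using (_⊎_)
open import Data.List using (List)
open import Data.List.Membership.Propositional using (_∈_)
open import Relation.Nullary using (¬_)
open import Relation.Binary.PropositionalEquality using (_≡_; _≢_)
open import Relation.Binary.Construct.Closure.Transitive using (TransClosure)
open import Function.Definitions using (Injective)
open import Function.Bundles using (_⤖_)

-- An oriented graph: a vertex type with an edge relation such that
-- (u,v) ∈ E implies (v,u) ∉ E (this also excludes loops).
record OrientedGraph : Set₁ where
  field
    V    : Set
    E    : V → V → Set
    asym : ∀ {u v} → E u v → ¬ E v u
open OrientedGraph public

record CountableOrientedGraph : Set₁ where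
  field
    graph : OrientedGraph
    code  : V graph → ℕ
    code-injective : Injective _≡_ _≡_ code
open CountableOrientedGraph public

-- A tournament: an oriented graph with exactly one edge between any two
-- distinct vertices (at most one follows from asymmetry).
IsTournament : OrientedGraph → Set
IsTournament G = ∀ (u v : V G) → u ≢ v → E G u v ⊎ E G v u

CountablyInfinite : OrientedGraph → Set
CountablyInfinite G = V G ⤖ ℕ

Embedding : OrientedGraph → OrientedGraph → Set
Embedding H G =
  Σ (V H → V G) λ φ →
    Injective _≡_ _≡_ φ × (∀ {u v} → E H u v → E G (φ u) (φ v))

Kω : OrientedGraph
Kω = record { V = ℕ ; E = λ i j → i < j ; asym = λ i<j j<i → <-asym i<j j<i }
  where open import Data.Nat.Properties using (<-asym)

Kω* : OrientedGraph
Kω* = record { V = ℕ ; E = λ i j → i > j ; asym = λ i>j j>i → <-asym i>j j>i }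
  where open import Data.Nat.Properties using (<-asym)

Acyclic : OrientedGraph → Set
Acyclic G = ∀ (v : V G) → ¬ TransClosure (E G) v v

LocallyFinite : OrientedGraph → Set
LocallyFinite G =
  ∀ (v : V G) → Σ (List (V G)) λ L → ∀ (u : V G) → (E G u v ⊎ E G v u) → u ∈ L

-- Infinite directed paths contained in G.
-- One-way infinite (ray), each vertex of in- and out-degree ≤ 1 in the path:
-- all edges oriented away from the origin, or all towards it.
OneWayInfiniteDirectedPath : OrientedGraph → Set
OneWayInfiniteDirectedPath G =
  Σ (ℕ → V G) λ f → Injective _≡_ _≡_ f ×
    ((∀ n → E G (f n) (f (suc n))) ⊎ (∀ n → E G (f (suc n)) (f n)))

TwoWayInfiniteDirectedPath : OrientedGraph → Set
TwoWayInfiniteDirectedPath G =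
  Σ (ℤ → V G) λ f → Injective _≡_ _≡_ f × (∀ z → E G (f z) (f (sucℤ z)))

InfiniteDirectedPath : OrientedGraph → Set
InfiniteDirectedPath G = OneWayInfiniteDirectedPath G ⊎ TwoWayInfiniteDirectedPath G

Unavoidable : OrientedGraph → Set₁
Unavoidable G = ∀ (K : OrientedGraph) → IsTournament K → CountablyInfinite K → Embedding G K

-- (i) ⇒ (ii): by König's lemma, local finiteness and the absence of backward
-- rays make every downset {u : u ≼ v} (the vertices with a directed walk to v)
-- finite, so v ↦ Σ_{u ≼ v} 2^(code u) is a natural number; acyclicity makes
-- this map injective and strictly increasing along edges, i.e. an embedding
-- into K_ω.  The reversed graph gives K_ω*.  (ii) ⇒ (i): an embedding into
-- K_ω rules out cycles and backward rays, one into K_ω* forward rays, and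
-- together they leave each vertex finitely many possible neighbours.
-- (ii) ⇒ (iii) is the infinite Ramsey theorem for tournaments: every countably
-- infinite tournament has a transitive subtournament of order type ω or ω*.
-- (iii) ⇒ (ii) holds since K_ω and K_ω* are themselves tournaments.
module Submission where

open import Level using (0ℓ)
open import Data.Bool using (Bool; true; false; T; if_then_else_)
open import Data.Unit using (⊤; tt)
open import Data.Empty using (⊥-elim)
open import Data.Nat
open import Data.Nat.Properties
open import Data.Nat.Induction using (<-wellFounded)
import Data.Integer as ℤ
open import Data.Product using (Σ; ∃; _×_; _,_; proj₁; proj₂)
open import Data.Sum using (_⊎_; inj₁; inj₂)
import Data.Sum as Sum
open import Data.List using (List; []; _∷_; _++_)
open import Data.List.Membership.Propositional using (_∈_)
open import Data.List.Membership.Propositional.Properties using (∈-++⁺ˡ; ∈-++⁺ʳ)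
open import Data.List.Relation.Unary.Any using (here; there)
open import Function.Base using (flip; _∘_; _∘′_)
open import Function.Bundles using (_⇔_; mk⇔; Inverse)
open import Function.Definitions using (Injective)
open import Function.Construct.Identity using (⤖-id)
open import Function.Properties.Bijection using (⤖⇒↔)
open import Relation.Nullary using (¬_; yes; no; contradiction)
open import Relation.Nullary.Decidable using (isYes; toWitness; fromWitness; decidable-stable)
open import Relation.Unary using (Pred; _⊆_; _∪_)
open import Relation.Binary.Core using (Rel)
open import Relation.Binary.Definitions using (tri<; tri≈; tri>)
open import Relation.Binary.PropositionalEquality
open import Relation.Binary.Construct.Closure.Transitive
  using (TransClosure; [_]; _∷_; _∷ʳ_) renaming (_++_ to _++⁺_)
open import Induction.InfiniteDescent
  using (Descent; InfiniteDescendingSequence; sequence⁺; descent∧wf⇒empty)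
open import Axiom.ExcludedMiddle using (ExcludedMiddle)
open import Defs

value : (ℕ → Bool) → ℕ → ℕ
value a zero    = 0
value a (suc k) = value a k + (if a k then 2 ^ k else 0)

private
  variable
    a b : ℕ → Bool
    k m n : ℕ

  if-mono : ∀ x y p → (T x → T y) → (if x then p else 0) ≤ (if y then p else 0)
  if-mono false y     p _   = z≤n
  if-mono true  true  p _   = ≤-refl
  if-mono true  false p x⇒y = ⊥-elim (x⇒y tt)

  if-strict : ∀ x y p → 0 < p → ¬ T x → T y → (if x then p else 0) < (if y then p else 0)
  if-strict true  y    p _   ¬x _ = ⊥-elim (¬x tt)
  if-strict false true p p>0 _  _ = p>0

value<2^ : ∀ a k → value a k < 2 ^ k
value<2^ a zero    = s≤s z≤n
value<2^ a (suc k) = begin-strict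
  value a k + (if a k then 2 ^ k else 0) <⟨ +-mono-<-≤ (value<2^ a k) (if-≤ (a k)) ⟩
  2 ^ k + 2 ^ k                           ≡⟨ cong (2 ^ k +_) (sym (+-identityʳ (2 ^ k))) ⟩
  2 ^ suc k                               ∎
  where
    open ≤-Reasoning
    if-≤ : ∀ x → (if x then 2 ^ k else 0) ≤ 2 ^ k
    if-≤ true  = ≤-refl
    if-≤ false = z≤n

value-mono : (∀ n → T (a n) → T (b n)) → ∀ k → value a k ≤ value b k
value-mono         a⊆b zero    = z≤n
value-mono {a} {b} a⊆b (suc k) =
  +-mono-≤ (value-mono a⊆b k) (if-mono (a k) (b k) (2 ^ k) (a⊆b k))

value-strict : (∀ n → T (a n) → T (b n)) → m < k → ¬ T (a m) → T (b m) →
               value a k < value b k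
value-strict {a} {b} {m} {suc k} a⊆b m<1+k ¬am bm with m≤n⇒m<n∨m≡n (s≤s⁻¹ m<1+k)
... | inj₁ m<k  = +-mono-<-≤ (value-strict a⊆b m<k ¬am bm) (if-mono (a k) (b k) (2 ^ k) (a⊆b k))
... | inj₂ refl = +-mono-≤-< (value-mono a⊆b k) (if-strict (a k) (b k) (2 ^ k) (m^n>0 2 k) ¬am bm)

value-stable : (∀ n → k ≤ n → ¬ T (a n)) → k ≤′ m → value a m ≡ value a k
value-stable         above ≤′-refl = refl
value-stable {a = a} above (≤′-step {n = m} k≤′m) with a m | above m (≤′⇒≤ k≤′m)
... | false | _   = trans (+-identityʳ _) (value-stable above k≤′m)
... | true  | ¬am = ⊥-elim (¬am tt)

value+2^≢value : ∀ a b k → value a k + 2 ^ k ≢ value b k + 0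
value+2^≢value a b k eq = <-irrefl (sym eq) (begin-strict
  value b k + 0     ≡⟨ +-identityʳ _ ⟩
  value b k         <⟨ value<2^ b k ⟩
  2 ^ k             ≤⟨ m≤n+m (2 ^ k) (value a k) ⟩
  value a k + 2 ^ k ∎)
  where open ≤-Reasoning

value-suc-injective : value a (suc k) ≡ value b (suc k) → a k ≡ b k × value a k ≡ value b k
value-suc-injective {a} {k} {b} eq with a k | b k
... | true  | true  = refl , +-cancelʳ-≡ (2 ^ k) _ _ eq
... | false | false = refl , +-cancelʳ-≡ 0 _ _ eq
... | true  | false = ⊥-elim (value+2^≢value a b k eq)
... | false | true  = ⊥-elim (value+2^≢value b a k (sym eq))

value-injective : value a k ≡ value b k → n < k → a n ≡ b n
value-injective {a} {suc k} {b} eq n<1+k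
  with value-suc-injective {a} {k} {b} eq | m≤n⇒m<n∨m≡n (s≤s⁻¹ n<1+k)
... | _     , eq′ | inj₁ n<k  = value-injective eq′ n<k
... | ak≡bk , _   | inj₂ refl = ak≡bk

Finite : {A : Set} → Pred A 0ℓ → Set
Finite {A} P = Σ (List A) λ L → ∀ x → P x → x ∈ L

module _ {A : Set} where

  finite-⊆ : {P Q : Pred A 0ℓ} → P ⊆ Q → Finite Q → Finite P
  finite-⊆ P⊆Q (L , Q⊆L) = L , λ x p → Q⊆L x (P⊆Q p)

  finite-∪ : {P Q : Pred A 0ℓ} → Finite P → Finite Q → Finite (P ∪ Q)
  finite-∪ (L , P⊆L) (M , Q⊆M) = L ++ M , λ
    { x (inj₁ p) → ∈-++⁺ˡ (P⊆L x p)
    ; x (inj₂ q) → ∈-++⁺ʳ L (Q⊆M x q) }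

  finite-≡ : (y : A) → Finite (_≡ y)
  finite-≡ y = y ∷ [] , λ { x refl → here refl }

  finite-⋃ : {P : A → Pred A 0ℓ} (L : List A) → (∀ x → x ∈ L → Finite (P x)) →
             Finite (λ y → ∃ λ x → x ∈ L × P x y)
  finite-⋃ []      _   = [] , λ { _ (_ , () , _) }
  finite-⋃ (x ∷ L) fin
    with fin x (here refl) | finite-⋃ L (λ x′ x′∈L → fin x′ (there x′∈L))
  ... | M , Px⊆M | N , rest⊆N = M ++ N , λ
    { y (_ , here refl , p)   → ∈-++⁺ˡ (Px⊆M y p)
    ; y (x′ , there x′∈L , p) → ∈-++⁺ʳ M (rest⊆N y (x′ , x′∈L , p)) }

  finite⇒bounded : {P : Pred A 0ℓ} (f : A → ℕ) → Finite P → ∃ λ k → ∀ x → P x → f x < k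
  finite⇒bounded {P} f (L , P⊆L) = bound L , λ x p → ∈⇒<bound (P⊆L x p)
    where
      bound : List A → ℕ
      bound []      = 0
      bound (x ∷ L) = suc (f x) + bound L

      ∈⇒<bound : ∀ {x L} → x ∈ L → f x < bound L
      ∈⇒<bound {L = y ∷ L} (here refl) = m≤m+n (suc (f y)) (bound L)
      ∈⇒<bound {L = y ∷ L} (there x∈L) =
        ≤-trans (∈⇒<bound x∈L) (m≤n+m (bound L) (suc (f y)))

Ascending : {A : Set} → Rel A 0ℓ → (ℕ → A) → Set
Ascending R f = ∀ {i j} → i < j → R (f i) (f j)

Unbounded : Pred ℕ 0ℓ → Set
Unbounded P = ∀ n → ∃ λ m → n ≤ m × P m

suc-increasing⇒increasing : {g : ℕ → ℕ} → (∀ i → g i < g (suc i)) → Ascending _<_ g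
suc-increasing⇒increasing {g} step = go ∘′ <⇒<′
  where
    go : ∀ {i j} → i <′ j → g i < g j
    go <′-base        = step _
    go (<′-step i<′j) = <-trans (go i<′j) (step _)

unbounded⇒enumeration : {P : Pred ℕ 0ℓ} → Unbounded P →
  ∃ λ g → Ascending _<_ g × ∀ i → P (g i)
unbounded⇒enumeration {P} unb =
  g , suc-increasing⇒increasing (λ i → proj₁ (proj₂ (unb (suc (g i))))) , g∈P
  where
    g : ℕ → ℕ
    g zero    = proj₁ (unb 0)
    g (suc i) = proj₁ (unb (suc (g i)))
    g∈P : ∀ i → P (g i)
    g∈P zero    = proj₂ (proj₂ (unb 0))
    g∈P (suc i) = proj₂ (proj₂ (unb (suc (g i))))

module _ {A : Set} {R : Rel A 0ℓ} where

  descent⇒infiniteDescendingSequence : {P : Pred A 0ℓ} → Descent R P →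
    ∀ {x} → P x → ∃ (InfiniteDescendingSequence R)
  descent⇒infiniteDescendingSequence {P} descent {x} Px =
    proj₁ ∘ walk , λ n → proj₁ (proj₂ (descent (proj₂ (walk n))))
    where
      walk : ℕ → Σ A P
      walk zero    = x , Px
      walk (suc n) with descent (proj₂ (walk n))
      ... | y , _ , Py = y , Py

  ascending⇒injective : (∀ {x} → ¬ R x x) → {f : ℕ → A} → Ascending R f →
                        Injective _≡_ _≡_ f
  ascending⇒injective irrefl {f} asc {i} {j} fi≡fj with <-cmp i j
  ... | tri< i<j _ _ = contradiction (subst (R (f i)) (sym fi≡fj) (asc i<j)) irrefl
  ... | tri≈ _ i≡j _ = i≡j
  ... | tri> _ _ j<i = contradiction (subst (R (f j)) fi≡fj (asc j<i)) irrefl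

  reverse⁺ : ∀ {x y} → TransClosure R x y → TransClosure (flip R) y x
  reverse⁺ [ r ]   = [ r ]
  reverse⁺ (r ∷ t) = reverse⁺ t ∷ʳ r

  module _ (φ : A → ℕ) (increasing : ∀ {u v} → R u v → φ u < φ v) where

    increasing⁺ : ∀ {u v} → TransClosure R u v → φ u < φ v
    increasing⁺ [ r ]   = increasing r
    increasing⁺ (r ∷ t) = <-trans (increasing r) (increasing⁺ t)

    increasing⇒no-descent : {f : ℕ → A} → ¬ InfiniteDescendingSequence R f
    increasing⇒no-descent {f} descending =
      descent∧wf⇒empty {P = Value} descent <-wellFounded _ (0 , refl)
      where
        Value : Pred ℕ 0ℓ
        Value m = ∃ λ n → φ (f n) ≡ m
        descent : Descent _<_ Value
        descent (n , refl) = φ (f (suc n)) , increasing (descending n) , suc n , refl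

module Classical (em : ExcludedMiddle 0ℓ) where

  finite-under : {A B : Set} {P : Pred A 0ℓ} → (B → Finite P) → Finite (λ x → B × P x)
  finite-under {B = B} fin with em {B}
  ... | yes b = finite-⊆ proj₂ (fin b)
  ... | no ¬b = [] , λ _ (b , _) → contradiction b ¬b

  finite-fibre : {A : Set} {f : A → ℕ} → Injective _≡_ _≡_ f →
                 ∀ n → Finite (λ x → f x ≡ n)
  finite-fibre {A} {f} f-injective n with em {∃ λ x → f x ≡ n}
  ... | yes (y , fy≡n) = y ∷ [] , λ x fx≡n → here (f-injective (trans fx≡n (sym fy≡n)))
  ... | no ∄x          = [] , λ x fx≡n → contradiction (x , fx≡n) ∄x

  finite-preimage-< : {A : Set} {f : A → ℕ} → Injective _≡_ _≡_ f →
                      ∀ n → Finite (λ x → f x < n)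
  finite-preimage-< f-injective zero    = [] , λ _ ()
  finite-preimage-< f-injective (suc n) =
    finite-⊆ (λ m<1+n → m≤n⇒m<n∨m≡n (s≤s⁻¹ m<1+n))
      (finite-∪ (finite-preimage-< f-injective n) (finite-fibre f-injective n))

  indicator : Pred ℕ 0ℓ → ℕ → Bool
  indicator P n = isYes (em {P n})

  encode : Pred ℕ 0ℓ → ℕ → ℕ
  encode P = value (indicator P)

  private
    variable
      P Q : Pred ℕ 0ℓ

  encode-stable : (∀ n → P n → n < k) → k ≤ m → encode P m ≡ encode P k
  encode-stable P<k k≤m =
    value-stable (λ n k≤n Pn → <⇒≱ (P<k n (toWitness Pn)) k≤n) (≤⇒≤′ k≤m)

  encode-⊂ : P ⊆ Q → m < k → ¬ P m → Q m → encode P k < encode Q k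
  encode-⊂ P⊆Q m<k ¬Pm Qm = value-strict (λ n Pn → fromWitness (P⊆Q (toWitness Pn))) m<k
    (λ Pm → ¬Pm (toWitness Pm)) (fromWitness Qm)

  encode-injective : encode P k ≡ encode Q k → n < k → P n → Q n
  encode-injective {P} {k} {Q} eq n<k Pn =
    toWitness (subst T (value-injective {indicator P} {k} {indicator Q} eq n<k) (fromWitness Pn))

  unbounded-∪ : {P Q : Pred ℕ 0ℓ} → Unbounded (P ∪ Q) → Unbounded P ⊎ Unbounded Q
  unbounded-∪ {P} {Q} unb with em {Unbounded P}
  ... | yes unbP = inj₁ unbP
  ... | no ¬unbP = inj₂ λ n → decidable-stable em λ ∄m → ¬unbP λ n′ → P-beyond n n′ ∄m
    where
      P-beyond : ∀ n n′ → ¬ (∃ λ m → n ≤ m × Q m) → ∃ λ m → n′ ≤ m × P m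
      P-beyond n n′ ∄m with unb (n + n′)
      ... | m , n+n′≤m , inj₁ Pm = m , ≤-trans (m≤n+m n′ n) n+n′≤m , Pm
      ... | m , n+n′≤m , inj₂ Qm = contradiction (m , ≤-trans (m≤m+n n n′) n+n′≤m , Qm) ∄m

  -- Starting from ℕ, repeatedly pick a point x of the current infinite set
  -- and keep the infinite side of the remaining points relative to x.  Then
  -- each chosen point beats all later ones or is beaten by all of them, and
  -- infinitely many points behave alike.
  module Ramsey (Beats : Rel ℕ 0ℓ) (total : ∀ m n → m ≢ n → Beats m n ⊎ Beats n m) where

    InfiniteSet : Set₁
    InfiniteSet = Σ (Pred ℕ 0ℓ) Unbounded

    point : InfiniteSet → ℕ
    point (_ , unb) = proj₁ (unb 0)

    point∈ : ((S , unb) : InfiniteSet) → S (point (S , unb))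
    point∈ (_ , unb) = proj₂ (proj₂ (unb 0))

    Dominates DominatedBy : ℕ → Pred ℕ 0ℓ → Set
    Dominates   x S = ∀ {m} → S m → Beats x m
    DominatedBy x S = ∀ {m} → S m → Beats m x

    split : ((S , unb) : InfiniteSet) → let x = point (S , unb) in
      Unbounded (λ m → S m × Beats x m) ⊎ Unbounded (λ m → S m × Beats m x)
    split (S , unb) = unbounded-∪ beyond
      where
        x = point (S , unb)
        beyond : Unbounded (λ m → (S m × Beats x m) ⊎ (S m × Beats m x))
        beyond n with unb (suc x + n)
        ... | m , x+n<m , Sm with total x m (<⇒≢ (≤-trans (m≤m+n (suc x) n) x+n<m))
        ...   | inj₁ Txm = m , ≤-trans (m≤n+m n (suc x)) x+n<m , inj₁ (Sm , Txm)
        ...   | inj₂ Tmx = m , ≤-trans (m≤n+m n (suc x)) x+n<m , inj₂ (Sm , Tmx)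

    refine : (s : InfiniteSet) → Σ InfiniteSet λ (S′ , _) →
      S′ ⊆ proj₁ s × (Dominates (point s) S′ ⊎ DominatedBy (point s) S′)
    refine s with split s
    ... | inj₁ unb = (_ , unb) , proj₁ , inj₁ proj₂
    ... | inj₂ unb = (_ , unb) , proj₁ , inj₂ proj₂

    sets : ℕ → InfiniteSet
    sets zero    = (λ _ → ⊤) , λ n → n , ≤-refl , tt
    sets (suc k) = proj₁ (refine (sets k))

    S : ℕ → Pred ℕ 0ℓ
    S k = proj₁ (sets k)

    x : ℕ → ℕ
    x k = point (sets k)

    sets-antitone : ∀ {k j} → k ≤′ j → S j ⊆ S k
    sets-antitone ≤′-refl                Sm = Sm
    sets-antitone (≤′-step {n = j} k≤′j) Sm =
      sets-antitone k≤′j (proj₁ (proj₂ (refine (sets j))) Sm)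

    later-in : ∀ {k j} → k < j → S (suc k) (x j)
    later-in {j = j} k<j = sets-antitone (≤⇒≤′ k<j) (point∈ (sets j))

    direction : ∀ k → Dominates (x k) (S (suc k)) ⊎ DominatedBy (x k) (S (suc k))
    direction k = proj₂ (proj₂ (refine (sets k)))

    ramsey : ∃ (Ascending Beats) ⊎ ∃ (Ascending (flip Beats))
    ramsey with unbounded-∪ (λ n → n , ≤-refl , direction n)
    ... | inj₁ unb = let g , g-asc , g-dom = unbounded⇒enumeration unb in
      inj₁ (x ∘ g , λ {i} {j} i<j → g-dom i (later-in {g i} {g j} (g-asc i<j)))
    ... | inj₂ unb = let g , g-asc , g-dom = unbounded⇒enumeration unb in
      inj₂ (x ∘ g , λ {i} {j} i<j → g-dom i (later-in {g i} {g j} (g-asc i<j)))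

op : OrientedGraph → OrientedGraph
op H = record { V = V H ; E = flip (E H) ; asym = asym H }

loopless : (K : OrientedGraph) → ∀ {v} → ¬ E K v v
loopless K e = asym K e e

acyclic-op : (H : OrientedGraph) → Acyclic H → Acyclic (op H)
acyclic-op H acyclic v t = acyclic v (reverse⁺ t)

descending⇒injective : (H : OrientedGraph) → Acyclic H → {f : ℕ → V H} →
  InfiniteDescendingSequence (E H) f → Injective _≡_ _≡_ f
descending⇒injective H acyclic {f} descending =
  ascending⇒injective {R = flip (TransClosure (E H))} (λ {v} → acyclic v) {f}
    (sequence⁺ {_<_ = E H} ([_] ∘ descending))

module Downsets (H : OrientedGraph) where

  infix 4 _≼_
  _≼_ : Rel (V H) 0ℓ
  u ≼ v = u ≡ v ⊎ TransClosure (E H) u v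

  private
    variable
      u v w : V H

  ≼-last : TransClosure (E H) u v → ∃ λ w → E H w v × u ≼ w
  ≼-last [ e ] = _ , e , inj₁ refl
  ≼-last (e ∷ t) with ≼-last t
  ... | w , e′ , inj₁ refl = w , e′ , inj₂ [ e ]
  ... | w , e′ , inj₂ t′   = w , e′ , inj₂ (e ∷ t′)

  ≼-∷ʳ : u ≼ v → E H v w → u ≼ w
  ≼-∷ʳ (inj₁ refl) e = inj₂ [ e ]
  ≼-∷ʳ (inj₂ t)    e = inj₂ (t ∷ʳ e)

  ≼-antisym : Acyclic H → u ≼ v → v ≼ u → u ≡ v
  ≼-antisym acyclic (inj₁ u≡v) _          = u≡v
  ≼-antisym acyclic (inj₂ t)   (inj₁ refl) = contradiction t (acyclic _)
  ≼-antisym acyclic (inj₂ t)   (inj₂ t′)   = contradiction (t ++⁺ t′) (acyclic _)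

  edge⇒⋠ : Acyclic H → E H u v → ¬ v ≼ u
  edge⇒⋠ acyclic e (inj₁ refl) = acyclic _ [ e ]
  edge⇒⋠ acyclic e (inj₂ t)    = acyclic _ (e ∷ t)

  module _ (em : ExcludedMiddle 0ℓ) (in-finite : ∀ v → Finite (λ w → E H w v)) where
    open Classical em

    finite-predecessor-downsets⇒finite-downset : (∀ w → E H w v → Finite (_≼ w)) → Finite (_≼ v)
    finite-predecessor-downsets⇒finite-downset {v} fin =
      finite-⊆ split (finite-∪ (finite-≡ v) (finite-⋃ L (λ w _ → finite-under (fin w))))
      where
        L = proj₁ (in-finite v)
        split : ∀ {u} → u ≼ v → u ≡ v ⊎ ∃ λ w → w ∈ L × (E H w v × u ≼ w)
        split (inj₁ u≡v) = inj₁ u≡v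
        split (inj₂ t) with ≼-last t
        ... | w , e , u≼w = inj₂ (w , proj₂ (in-finite v) w e , e , u≼w)

    infinite-downset-descent : Descent (E H) (λ v → ¬ Finite (_≼ v))
    infinite-downset-descent ¬fin = decidable-stable em λ ∄w →
      ¬fin (finite-predecessor-downsets⇒finite-downset λ w e →
        decidable-stable em λ ¬finw → ∄w (w , e , ¬finw))

    downsets-finite : ¬ ∃ (InfiniteDescendingSequence (E H)) → ∀ v → Finite (_≼ v)
    downsets-finite no-descent v = decidable-stable em λ ¬fin →
      no-descent (descent⇒infiniteDescendingSequence infinite-downset-descent ¬fin)

  module DownsetCode (em : ExcludedMiddle 0ℓ)
    (code : V H → ℕ) (code-injective : Injective _≡_ _≡_ code)
    (acyclic : Acyclic H) (finite : ∀ v → Finite (_≼ v)) where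
    open Classical em

    Codes : V H → Pred ℕ 0ℓ
    Codes v n = ∃ λ u → u ≼ v × code u ≡ n

    bound : V H → ℕ
    bound v = proj₁ (finite⇒bounded code (finite v))

    codes<bound : ∀ v n → Codes v n → n < bound v
    codes<bound v n (u , u≼v , refl) = proj₂ (finite⇒bounded code (finite v)) u u≼v

    own-code : ∀ v → Codes v (code v)
    own-code v = v , inj₁ refl , refl

    code<bound : ∀ v → code v < bound v
    code<bound v = codes<bound v (code v) (own-code v)

    codes-reflect : Codes v (code u) → u ≼ v
    codes-reflect {v} (w , w≼v , cw≡cu) = subst (_≼ v) (code-injective cw≡cu) w≼v

    φ : V H → ℕ
    φ v = encode (Codes v) (bound v)

    φ-at : ∀ v {k} → bound v ≤ k → φ v ≡ encode (Codes v) k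
    φ-at v b≤k = sym (encode-stable (codes<bound v) b≤k)

    φ-increasing : E H u v → φ u < φ v
    φ-increasing {u} {v} e = begin-strict
      φ u                ≡⟨ φ-at u bu≤N ⟩
      encode (Codes u) N <⟨ encode-⊂ Codes-u⊆Codes-v code-v<N v∉Codes-u (own-code v) ⟩
      encode (Codes v) N ≡⟨ φ-at v bv≤N ⟨
      φ v                ∎
      where
        open ≤-Reasoning
        N = bound u + bound v
        bu≤N = m≤m+n (bound u) (bound v)
        bv≤N = m≤n+m (bound v) (bound u)
        code-v<N = <-≤-trans (code<bound v) bv≤N
        Codes-u⊆Codes-v : ∀ {n} → Codes u n → Codes v n
        Codes-u⊆Codes-v (w , w≼u , cw≡n) = w , ≼-∷ʳ w≼u e , cw≡n
        v∉Codes-u : ¬ Codes u (code v)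
        v∉Codes-u c = edge⇒⋠ acyclic e (codes-reflect c)

    φ-injective : Injective _≡_ _≡_ φ
    φ-injective {u} {v} φu≡φv = ≼-antisym acyclic
      (codes-reflect (encode-injective same-code (<-≤-trans (code<bound u) bu≤N) (own-code u)))
      (codes-reflect (encode-injective (sym same-code) (<-≤-trans (code<bound v) bv≤N) (own-code v)))
      where
        N = bound u + bound v
        bu≤N = m≤m+n (bound u) (bound v)
        bv≤N = m≤n+m (bound v) (bound u)
        same-code : encode (Codes u) N ≡ encode (Codes v) N
        same-code = trans (sym (φ-at u bu≤N)) (trans φu≡φv (φ-at v bv≤N))

embedding-into-Kω : ExcludedMiddle 0ℓ → (H : OrientedGraph) →
  (code : V H → ℕ) → Injective _≡_ _≡_ code → Acyclic H →
  (∀ v → Finite (λ w → E H w v)) → ¬ ∃ (InfiniteDescendingSequence (E H)) →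
  Embedding H Kω
embedding-into-Kω em H code code-injective acyclic in-finite no-descent =
  φ , φ-injective , φ-increasing
  where
    open Downsets H
    open DownsetCode em code code-injective acyclic (downsets-finite em in-finite no-descent)

op-embedding-Kω⇒embedding-Kω* : {H : OrientedGraph} → Embedding (op H) Kω → Embedding H Kω*
op-embedding-Kω⇒embedding-Kω* (φ , φ-injective , φ-increasing) = φ , φ-injective , φ-increasing

embedding-trans : {G H K : OrientedGraph} → Embedding G H → Embedding H K → Embedding G K
embedding-trans (g , g-injective , g-edges) (f , f-injective , f-edges) =
  f ∘ g , g-injective ∘ f-injective , f-edges ∘ g-edges

ascending⇒embedding-Kω : (K : OrientedGraph) {f : ℕ → V K} → Ascending (E K) f → Embedding Kω K
ascending⇒embedding-Kω K {f} asc = f , ascending⇒injective {R = E K} (loopless K) asc , asc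

descending⇒embedding-Kω* : (K : OrientedGraph) {f : ℕ → V K} → Ascending (flip (E K)) f →
  Embedding Kω* K
descending⇒embedding-Kω* K {f} desc = f , ascending⇒injective {R = flip (E K)} (loopless K) desc , desc

tournament⇒embedding-Kω⊎Kω* : ExcludedMiddle 0ℓ → (K : OrientedGraph) → IsTournament K →
  CountablyInfinite K → Embedding Kω K ⊎ Embedding Kω* K
tournament⇒embedding-Kω⊎Kω* em K tournament countable =
  Sum.map (λ (f , asc) → ascending⇒embedding-Kω K {from ∘ f} asc)
          (λ (f , desc) → descending⇒embedding-Kω* K {from ∘ f} desc)
          (Classical.Ramsey.ramsey em Beats total)
  where
    open Inverse (⤖⇒↔ countable) using (to; from; strictlyInverseˡ)
    Beats : Rel ℕ 0ℓ
    Beats m n = E K (from m) (from n)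
    total : ∀ m n → m ≢ n → Beats m n ⊎ Beats n m
    total m n m≢n = tournament (from m) (from n) λ eq →
      m≢n (trans (sym (strictlyInverseˡ m)) (trans (cong to eq) (strictlyInverseˡ n)))

Kω-tournament : IsTournament Kω
Kω-tournament m n m≢n with <-cmp m n
... | tri< m<n _ _ = inj₁ m<n
... | tri≈ _ m≡n _ = contradiction m≡n m≢n
... | tri> _ _ n<m = inj₂ n<m

Kω*-tournament : IsTournament Kω*
Kω*-tournament m n m≢n = Sum.swap (Kω-tournament m n m≢n)

embedding-Kω⇒acyclic : (H : OrientedGraph) → Embedding H Kω → Acyclic H
embedding-Kω⇒acyclic H (φ , _ , φ-increasing) v cycle =
  <-irrefl refl (increasing⁺ φ φ-increasing cycle)

embeddings⇒locally-finite : ExcludedMiddle 0ℓ → (H : OrientedGraph) →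
  Embedding H Kω → Embedding H Kω* → LocallyFinite H
embeddings⇒locally-finite em H (φ , φ-injective , φ-increasing) (ψ , ψ-injective , ψ-decreasing) v =
  finite-⊆ (Sum.map φ-increasing ψ-decreasing)
    (finite-∪ (finite-preimage-< φ-injective (φ v)) (finite-preimage-< ψ-injective (ψ v)))
  where open Classical em

embeddings⇒no-infinite-path : (H : OrientedGraph) →
  Embedding H Kω → Embedding H Kω* → ¬ InfiniteDirectedPath H
embeddings⇒no-infinite-path H (φ , _ , φ-increasing) (ψ , _ , ψ-decreasing) = λ where
  (inj₁ (f , _ , inj₁ forward))  → increasing⇒no-descent ψ ψ-decreasing forward
  (inj₁ (f , _ , inj₂ backward)) → increasing⇒no-descent φ φ-increasing backward
  (inj₂ (f , _ , forward))       → increasing⇒no-descent ψ ψ-decreasing (forward ∘ ℤ.+_)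

module _ (em : ExcludedMiddle 0ℓ) (G : CountableOrientedGraph) where
  private
    H = graph G

  structure⇒embeddings : Acyclic H × LocallyFinite H × ¬ InfiniteDirectedPath H →
                         Embedding H Kω × Embedding H Kω*
  structure⇒embeddings (acyclic , locally-finite , no-path) =
    embedding-into-Kω em H (code G) (code-injective G) acyclic
      (λ v → finite-⊆ inj₁ (locally-finite v)) no-backward-ray ,
    op-embedding-Kω⇒embedding-Kω* {H} (embedding-into-Kω em (op H) (code G) (code-injective G)
      acyclic′ (λ v → finite-⊆ inj₂ (locally-finite v)) no-forward-ray)
    where
      acyclic′ = acyclic-op H acyclic
      no-backward-ray : ¬ ∃ (InfiniteDescendingSequence (E H))
      no-backward-ray (f , backward) =
        no-path (inj₁ (f , descending⇒injective H acyclic backward , inj₂ backward))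
      no-forward-ray : ¬ ∃ (InfiniteDescendingSequence (E (op H)))
      no-forward-ray (f , forward) =
        no-path (inj₁ (f , descending⇒injective (op H) acyclic′ forward , inj₁ forward))

  embeddings⇒structure : Embedding H Kω × Embedding H Kω* →
                         Acyclic H × LocallyFinite H × ¬ InfiniteDirectedPath H
  embeddings⇒structure (eω , eω*) =
    embedding-Kω⇒acyclic H eω ,
    embeddings⇒locally-finite em H eω eω* ,
    embeddings⇒no-infinite-path H eω eω*

  embeddings⇒unavoidable : Embedding H Kω × Embedding H Kω* → Unavoidable H
  embeddings⇒unavoidable (eω , eω*) K tournament countable =
    Sum.[ embedding-trans {H} {Kω} {K} eω , embedding-trans {H} {Kω*} {K} eω* ]
      (tournament⇒embedding-Kω⊎Kω* em K tournament countable)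

  unavoidable⇒embeddings : Unavoidable H → Embedding H Kω × Embedding H Kω*
  unavoidable⇒embeddings unavoidable =
    unavoidable Kω Kω-tournament (⤖-id ℕ) , unavoidable Kω* Kω*-tournament (⤖-id ℕ)

theorem2p3 : ExcludedMiddle 0ℓ → (G : CountableOrientedGraph) →
    ((Acyclic (graph G) × LocallyFinite (graph G) × ¬ InfiniteDirectedPath (graph G))
       ⇔ (Embedding (graph G) Kω × Embedding (graph G) Kω*))
    × ((Embedding (graph G) Kω × Embedding (graph G) Kω*)
       ⇔ Unavoidable (graph G))
theorem2p3 em G =
  mk⇔ (structure⇒embeddings em G) (embeddings⇒structure em G) ,
  mk⇔ (embeddings⇒unavoidable em G) (unavoidable⇒embeddings em G)
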